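{- For all integers $n\ge 0$ and $r\ge 0$, \[ B_{n,r}^{L}=\frac{1}{e}\sum_{k=0}^{\infty}\frac{\langle k+2r\rangle_{n}}{k!}. \]
   Context: For a nonnegative integer $r$ and integers $0\le k\le n$, the $r$-Lah number $L_r(n,k)$ is the number of partitions of a set with $n+r$ elements into $k+r$ non-empty linearly ordered subsets such that $r$ distinguished elements lie in distinct subsets; equivalently $L_r(n,k)=\frac{n!}{k!}\binom{n+2r-1}{k+2r-1}$. The $r$-extended Lah-Bell number is $B^L_{n,r}=\sum_{k=0}^n L_r(n,k)$ (the number of ways to partition a set of $n+r$ elements into non-empty linearly ordered subsets with $r$ distinguished elements in distinct subsets). The rising factorial is $\langle x\rangle_0=1$, $\langle x\rangle_n=x(x+1)\cdots(x+n-1)$ for $n\ge1$. -}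

module Defs where

open import Data.Nat using (ℕ; zero; suc; _+_; _*_; _∸_; _!)
open import Data.Nat.Properties using (_!≢0)
open import Data.Nat.Combinatorics using (_C_)
open import Data.Integer using (+_)
open import Data.Rational using (ℚ; 0ℚ; _/_; _<_; _-_; ∣_∣) renaming (_+_ to _+ℚ_; _*_ to _*ℚ_)

rising : ℕ → ℕ → ℕ
rising x zero    = 1
rising x (suc m) = rising x m * (x + m)

-- n!/k! for k ≤ n, written as the exact product (k+1)(k+2)⋯n
-- (only used with k ≤ n)
factRatio : ℕ → ℕ → ℕ
factRatio n k = rising (suc k) (n ∸ k)

-- The degenerate case k + 2r = 0 (i.e. r = 0, k = 0) uses the convention
-- binom(n-1, -1) = [n = 0], so L_0(n,0) = [n = 0].
lah : ℕ → ℕ → ℕ → ℕ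
lah r n k with k + (r + r)
... | zero  with n
...   | zero  = 1
...   | suc _ = 0
lah r n k | suc m = factRatio n k * ((n + (r + r) ∸ 1) C m)

sumTo : ℕ → (ℕ → ℕ) → ℕ
sumTo zero    f = f 0
sumTo (suc n) f = sumTo n f + f (suc n)

lahBell : ℕ → ℕ → ℕ
lahBell n r = sumTo n (lah r n)

sumBelowℚ : ℕ → (ℕ → ℚ) → ℚ
sumBelowℚ zero    f = 0ℚ
sumBelowℚ (suc M) f = sumBelowℚ M f +ℚ f M

seriesPartial : ℕ → ℕ → ℕ → ℚ
seriesPartial n r M = sumBelowℚ M (λ k → ((+ rising (k + (r + r)) n) / (k !)) {{k !≢0}})

ePartial : ℕ → ℚ
ePartial M = sumBelowℚ M (λ k → ((+ 1) / (k !)) {{k !≢0}})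

module Submission where

-- (1) Lah expansion.  With the falling factorial (k)_j = j!·C(k,j),
--       ⟨k+2r⟩_n = Σ_{j≤n} L_r(n,j) · (k)_j ,
--     a consequence of Vandermonde's convolution and ⟨y+1⟩_n = n!·C(y+n,y).
-- (2) Exact identity at level M.  Multiply (1) by M!/k! and sum over k < M.
--     Since Σ_{k<M} (k)_j · M!/k! = Σ_{i<M-j} M!/i!, which is M!·E_M minus a
--     remainder R_M(j) of j terms (E_M = Σ_{i<M} 1/i!), we get for n ≤ M
--       M!·S_M + D_M = B^L_{n,r} · M!·E_M ,   D_M = Σ_{j≤n} L_r(n,j)·R_M(j),
--     where S_M = Σ_{k<M} ⟨k+2r⟩_n / k!.  Everything here lives in ℕ.
-- (3) Smallness.  Each term of R_M(j) is at most M!/(M-n)!, hence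
--     D_M·(M-n)! ≤ B^L_{n,r}·n·M!, so D_M/M! → 0 because (M-n)! → ∞.
-- (4) Transfer to ℚ.  Both partial sums are fractions over M!, so by (2)
--     |S_M - B^L_{n,r}·E_M| = D_M/M!, and (3) makes this smaller than ε.

open import Defs

open import Data.Nat using (ℕ; zero; suc; _+_; _*_; _∸_; _!; _≤_; _<_; _≥_; z≤n; s≤s; NonZero)
open import Data.Nat.Properties
open import Data.Nat.Combinatorics using (_C_; nCk+nC[k+1]≡[n+1]C[k+1]; k![n∸k]!∣n!)
open import Data.Nat.Combinatorics.Specification using (nCk≡n!/k![n-k]!; k>n⇒nCk≡0)
open import Data.Nat.DivMod using (m/n*n≡m)
open import Data.Nat.Tactic.RingSolver using (solve-∀)
open import Data.Sum using (inj₁; inj₂)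
open import Data.Product using (Σ; _,_)
import Data.Integer as ℤ
import Data.Integer.Properties as ℤP
import Data.Integer.Tactic.RingSolver as ℤSolver
open import Data.Rational as ℚ using (ℚ; mkℚ; 0ℚ; _/_; _-_; ∣_∣; toℚᵘ)
  renaming (_*_ to _*ℚ_; _+_ to _+ℚ_; -_ to -ℚ_; _<_ to _<ℚ_)
import Data.Rational.Properties as ℚP
open import Data.Rational.Unnormalised using (ℚᵘ; mkℚᵘ; _≃_; *≡*; *<*)
  renaming (_+_ to _+ᵘ_; _*_ to _*ᵘ_; -_ to -ᵘ_; _<_ to _<ᵘ_; ∣_∣ to ∣_∣ᵘ)
import Data.Rational.Unnormalised.Properties as ℚᵘP
open import Relation.Binary.PropositionalEquality

sumBelow : ℕ → (ℕ → ℕ) → ℕ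
sumBelow zero    f = 0
sumBelow (suc M) f = sumBelow M f + f M

sumTo-cong : ∀ n {f g : ℕ → ℕ} → (∀ j → j ≤ n → f j ≡ g j) → sumTo n f ≡ sumTo n g
sumTo-cong zero    eq = eq 0 z≤n
sumTo-cong (suc n) eq = cong₂ _+_ (sumTo-cong n (λ j j≤n → eq j (m≤n⇒m≤1+n j≤n))) (eq (suc n) ≤-refl)

sumTo-zero : ∀ n (f : ℕ → ℕ) → (∀ j → j ≤ n → f j ≡ 0) → sumTo n f ≡ 0
sumTo-zero zero    f z = z 0 z≤n
sumTo-zero (suc n) f z = cong₂ _+_ (sumTo-zero n f (λ j j≤n → z j (m≤n⇒m≤1+n j≤n))) (z (suc n) ≤-refl)

sumTo-+ : ∀ n (f g : ℕ → ℕ) → sumTo n (λ j → f j + g j) ≡ sumTo n f + sumTo n g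
sumTo-+ zero    f g = refl
sumTo-+ (suc n) f g = trans (cong (_+ (f (suc n) + g (suc n))) (sumTo-+ n f g)) (+-interchange (sumTo n f) (sumTo n g) (f (suc n)) (g (suc n)))
  where
  +-interchange : ∀ a b c d → a + b + (c + d) ≡ a + c + (b + d)
  +-interchange = solve-∀

sumTo-*ˡ : ∀ n c (f : ℕ → ℕ) → sumTo n (λ j → c * f j) ≡ c * sumTo n f
sumTo-*ˡ zero    c f = refl
sumTo-*ˡ (suc n) c f = trans (cong (_+ c * f (suc n)) (sumTo-*ˡ n c f)) (sym (*-distribˡ-+ c _ _))

sumTo-*ʳ : ∀ n c (f : ℕ → ℕ) → sumTo n (λ j → f j * c) ≡ sumTo n f * c
sumTo-*ʳ zero    c f = refl
sumTo-*ʳ (suc n) c f = trans (cong (_+ f (suc n) * c) (sumTo-*ʳ n c f)) (sym (*-distribʳ-+ c (sumTo n f) (f (suc n))))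

sumTo-mono : ∀ n {f g : ℕ → ℕ} → (∀ j → j ≤ n → f j ≤ g j) → sumTo n f ≤ sumTo n g
sumTo-mono zero    le = le 0 z≤n
sumTo-mono (suc n) le = +-mono-≤ (sumTo-mono n (λ j j≤n → le j (m≤n⇒m≤1+n j≤n))) (le (suc n) ≤-refl)

sumTo-shift : ∀ n f → sumTo (suc n) f ≡ f 0 + sumTo n (λ j → f (suc j))
sumTo-shift zero    f = refl
sumTo-shift (suc n) f = trans (cong (_+ f (suc (suc n))) (sumTo-shift n f)) (+-assoc (f 0) _ _)

sumTo-vanishing-tail : ∀ n t (f : ℕ → ℕ) → (∀ j → n < j → f j ≡ 0) → sumTo (n + t) f ≡ sumTo n f
sumTo-vanishing-tail n zero    f z = cong (λ m → sumTo m f) (+-identityʳ n)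
sumTo-vanishing-tail n (suc t) f z rewrite +-suc n t =
  trans (cong₂ _+_ (sumTo-vanishing-tail n t f z) (z (suc (n + t)) (s≤s (m≤m+n n t)))) (+-identityʳ _)

sumBelow-cong : ∀ M {f g : ℕ → ℕ} → (∀ k → k < M → f k ≡ g k) → sumBelow M f ≡ sumBelow M g
sumBelow-cong zero    eq = refl
sumBelow-cong (suc M) eq = cong₂ _+_ (sumBelow-cong M (λ k k<M → eq k (m≤n⇒m≤1+n k<M))) (eq M ≤-refl)

sumBelow-zero : ∀ M (f : ℕ → ℕ) → (∀ k → k < M → f k ≡ 0) → sumBelow M f ≡ 0
sumBelow-zero zero    f z = refl
sumBelow-zero (suc M) f z = cong₂ _+_ (sumBelow-zero M f (λ k k<M → z k (m≤n⇒m≤1+n k<M))) (z M ≤-refl)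

sumBelow-*ˡ : ∀ M c (f : ℕ → ℕ) → sumBelow M (λ k → c * f k) ≡ c * sumBelow M f
sumBelow-*ˡ zero    c f = sym (*-zeroʳ c)
sumBelow-*ˡ (suc M) c f = trans (cong (_+ c * f M) (sumBelow-*ˡ M c f)) (sym (*-distribˡ-+ c _ _))

sumBelow-*ʳ : ∀ M c (f : ℕ → ℕ) → sumBelow M (λ k → f k * c) ≡ sumBelow M f * c
sumBelow-*ʳ zero    c f = refl
sumBelow-*ʳ (suc M) c f = trans (cong (_+ f M * c) (sumBelow-*ʳ M c f)) (sym (*-distribʳ-+ c (sumBelow M f) (f M)))

sumBelow-split : ∀ a b (f : ℕ → ℕ) → sumBelow (a + b) f ≡ sumBelow a f + sumBelow b (λ i → f (a + i))
sumBelow-split a zero    f = trans (cong (λ m → sumBelow m f) (+-identityʳ a)) (sym (+-identityʳ _))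
sumBelow-split a (suc b) f rewrite +-suc a b =
  trans (cong (_+ f (a + b)) (sumBelow-split a b f)) (+-assoc (sumBelow a f) _ _)

sumBelow-bound : ∀ M c (f : ℕ → ℕ) → (∀ k → k < M → f k ≤ c) → sumBelow M f ≤ M * c
sumBelow-bound zero    c f le = z≤n
sumBelow-bound (suc M) c f le = subst (sumBelow M f + f M ≤_) (+-comm (M * c) c)
  (+-mono-≤ (sumBelow-bound M c f (λ k k<M → le k (m≤n⇒m≤1+n k<M))) (le M ≤-refl))

sumBelow-sumTo-swap : ∀ M n (g : ℕ → ℕ → ℕ) →
  sumBelow M (λ k → sumTo n (λ j → g j k)) ≡ sumTo n (λ j → sumBelow M (g j))
sumBelow-sumTo-swap zero    n g = sym (sumTo-zero n (λ _ → 0) (λ _ _ → refl))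
sumBelow-sumTo-swap (suc M) n g =
  trans (cong (_+ sumTo n (λ j → g j M)) (sumBelow-sumTo-swap M n g))
        (sym (sumTo-+ n (λ j → sumBelow M (g j)) (λ j → g j M)))

factorial-mono : ∀ {m n} → m ≤ n → m ! ≤ n !
factorial-mono {m} {zero}  z≤n = ≤-refl
factorial-mono {m} {suc n} m≤1+n with m≤n⇒m<n∨m≡n m≤1+n
... | inj₁ (s≤s m≤n) = ≤-trans (factorial-mono m≤n) (m≤n*m (n !) (suc n))
... | inj₂ refl      = ≤-refl

-- n ≤ n!, the (crude) growth of the factorial that drives the convergence.
n≤n! : ∀ n → n ≤ n !
n≤n! zero    = z≤n
n≤n! (suc n) = subst (_≤ suc n * n !) (*-identityʳ (suc n)) (*-monoʳ-≤ (suc n) (1≤n! n))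

rising-factorial : ∀ y n → rising (suc y) n * y ! ≡ (y + n) !
rising-factorial y zero    = trans (+-identityʳ (y !)) (cong _! (sym (+-identityʳ y)))
rising-factorial y (suc n) = begin
    rising (suc y) n * (suc y + n) * y !
  ≡⟨ swap₂₃ (rising (suc y) n) (suc y + n) (y !) ⟩
    rising (suc y) n * y ! * (suc y + n)
  ≡⟨ cong (_* (suc y + n)) (rising-factorial y n) ⟩
    (y + n) ! * suc (y + n)
  ≡⟨ *-comm ((y + n) !) (suc (y + n)) ⟩
    suc (y + n) !
  ≡⟨ cong _! (sym (+-suc y n)) ⟩
    (y + suc n) ! ∎
  where
  open ≡-Reasoning
  swap₂₃ : ∀ a b c → a * b * c ≡ a * c * b
  swap₂₃ = solve-∀

factRatio-factorial : ∀ M k → k ≤ M → factRatio M k * k ! ≡ M !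
factRatio-factorial M k k≤M = trans (rising-factorial k (M ∸ k)) (cong _! (m+[n∸m]≡n k≤M))

binomial-factorial : ∀ a b → ((a + b) C a) * (a ! * b !) ≡ (a + b) !
binomial-factorial a b =
  subst (λ z → ((a + b) C a) * (a ! * z !) ≡ (a + b) !) (m+n∸m≡n a b) quotient
  where
  a≤a+b : a ≤ a + b
  a≤a+b = m≤m+n a b
  instance
    denominator≢0 : NonZero (a ! * (a + b ∸ a) !)
    denominator≢0 = a !* (a + b ∸ a) !≢0
  quotient : ((a + b) C a) * (a ! * (a + b ∸ a) !) ≡ (a + b) !
  quotient rewrite nCk≡n!/k![n-k]! a≤a+b = m/n*n≡m (k![n∸k]!∣n! a≤a+b)

binomial-symmetric : ∀ a b → (a + b) C a ≡ (b + a) C b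
binomial-symmetric a b = *-cancelʳ-≡ _ _ (a ! * b !) {{a !* b !≢0}} (begin
    ((a + b) C a) * (a ! * b !)
  ≡⟨ binomial-factorial a b ⟩
    (a + b) !
  ≡⟨ cong _! (+-comm a b) ⟩
    (b + a) !
  ≡⟨ sym (binomial-factorial b a) ⟩
    ((b + a) C b) * (b ! * a !)
  ≡⟨ cong (((b + a) C b) *_) (*-comm (b !) (a !)) ⟩
    ((b + a) C b) * (a ! * b !) ∎)
  where open ≡-Reasoning

rising-binomial : ∀ y n → rising (suc y) n ≡ n ! * ((y + n) C y)
rising-binomial y n = *-cancelʳ-≡ _ _ (y !) {{y !≢0}} (begin
    rising (suc y) n * y !
  ≡⟨ rising-factorial y n ⟩
    (y + n) !
  ≡⟨ sym (binomial-factorial y n) ⟩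
    ((y + n) C y) * (y ! * n !)
  ≡⟨ rearrange ((y + n) C y) (y !) (n !) ⟩
    n ! * ((y + n) C y) * y ! ∎)
  where
  open ≡-Reasoning
  rearrange : ∀ a b c → a * (b * c) ≡ c * a * b
  rearrange = solve-∀

rising-zero : ∀ n → rising 0 (suc n) ≡ 0
rising-zero zero    = refl
rising-zero (suc n) = cong (_* suc n) (rising-zero n)

-- Vandermonde's convolution, with an offset c and a truncation bound K ≥ x:
--   Σ_{j≤K} C(a, c+j) · C(x, j) = C(a+x, c+x).
-- Induction on x, splitting C(x+1, j+1) by Pascal's rule.
vandermonde : ∀ a x c K → x ≤ K → sumTo K (λ j → (a C (c + j)) * (x C j)) ≡ (a + x) C (c + x)
vandermonde a zero c K _ = begin
    sumTo K (λ j → (a C (c + j)) * (0 C j))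
  ≡⟨ sumTo-vanishing-tail 0 K _ vanishes ⟩
    (a C (c + 0)) * 1
  ≡⟨ *-identityʳ _ ⟩
    a C (c + 0)
  ≡⟨ cong (_C (c + 0)) (sym (+-identityʳ a)) ⟩
    (a + 0) C (c + 0) ∎
  where
  open ≡-Reasoning
  vanishes : ∀ j → 0 < j → (a C (c + j)) * (0 C j) ≡ 0
  vanishes (suc j) _ = *-zeroʳ (a C (c + suc j))
vandermonde a (suc x) c (suc K) (s≤s x≤K) = begin
    sumTo (suc K) (λ j → (a C (c + j)) * (suc x C j))
  ≡⟨ sumTo-shift K _ ⟩
    g 0 + sumTo K (λ j → (a C (c + suc j)) * (suc x C suc j))
  ≡⟨ cong (g 0 +_) (sumTo-cong K (λ j _ → pascal j)) ⟩
    g 0 + sumTo K (λ j → g (suc j) + h j)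
  ≡⟨ cong (g 0 +_) (sumTo-+ K (λ j → g (suc j)) h) ⟩
    g 0 + (sumTo K (λ j → g (suc j)) + sumTo K h)
  ≡⟨ sym (+-assoc (g 0) _ _) ⟩
    (g 0 + sumTo K (λ j → g (suc j))) + sumTo K h
  ≡⟨ cong (_+ sumTo K h) (sym (sumTo-shift K g)) ⟩
    sumTo (suc K) g + sumTo K h
  ≡⟨ cong₂ _+_ (vandermonde a x c (suc K) (m≤n⇒m≤1+n x≤K)) (vandermonde a x (suc c) K x≤K) ⟩
    ((a + x) C (c + x)) + ((a + x) C (suc (c + x)))
  ≡⟨ nCk+nC[k+1]≡[n+1]C[k+1] (a + x) (c + x) ⟩
    suc (a + x) C suc (c + x)
  ≡⟨ cong₂ _C_ (sym (+-suc a x)) (sym (+-suc c x)) ⟩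
    (a + suc x) C (c + suc x) ∎
  where
  open ≡-Reasoning
  g h : ℕ → ℕ
  g j = (a C (c + j)) * (x C j)
  h j = (a C (suc c + j)) * (x C j)
  pascal : ∀ j → (a C (c + suc j)) * (suc x C suc j) ≡ g (suc j) + h j
  pascal j = begin
      (a C (c + suc j)) * (suc x C suc j)
    ≡⟨ cong ((a C (c + suc j)) *_) (sym (nCk+nC[k+1]≡[n+1]C[k+1] x j)) ⟩
      (a C (c + suc j)) * ((x C j) + (x C suc j))
    ≡⟨ *-distribˡ-+ (a C (c + suc j)) (x C j) (x C suc j) ⟩
      (a C (c + suc j)) * (x C j) + (a C (c + suc j)) * (x C suc j)
    ≡⟨ +-comm ((a C (c + suc j)) * (x C j)) _ ⟩
      (a C (c + suc j)) * (x C suc j) + (a C (c + suc j)) * (x C j)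
    ≡⟨ cong (λ t → (a C (c + suc j)) * (x C suc j) + (a C t) * (x C j)) (+-suc c j) ⟩
      g (suc j) + h j ∎

-- The falling factorial (k)_j = k(k-1)⋯(k-j+1) = j! · C(k, j).
falling : ℕ → ℕ → ℕ
falling k j = j ! * (k C j)

lah-scaled : ∀ r n j m → j ≤ n → j + (r + r) ≡ suc m → lah r n j * j ! ≡ n ! * ((n + (r + r) ∸ 1) C m)
lah-scaled r n j m j≤n eq = begin
    lah r n j * j !
  ≡⟨ cong (_* j !) (lah-unfold eq) ⟩
    factRatio n j * b * j !
  ≡⟨ swap₂₃ (factRatio n j) b (j !) ⟩
    factRatio n j * j ! * b
  ≡⟨ cong (_* b) (factRatio-factorial n j j≤n) ⟩
    n ! * b ∎
  where
  open ≡-Reasoning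
  b : ℕ
  b = (n + (r + r) ∸ 1) C m
  lah-unfold : j + (r + r) ≡ suc m → lah r n j ≡ factRatio n j * b
  lah-unfold j+2r≡1+m with j + (r + r) | j+2r≡1+m
  ... | .(suc m) | refl = refl
  swap₂₃ : ∀ a b c → a * b * c ≡ a * c * b
  swap₂₃ = solve-∀

-- For r ≥ 1 both sides are n!·C(n+2r-1+k, 2r-1+k) by Vandermonde; for r = 0
-- the index is shifted by one (L_0(n+1, 0) = 0) and Vandermonde is applied
-- with offset 1.
lah-expansion : ∀ r n k → rising (k + (r + r)) n ≡ sumTo n (λ j → lah r n j * falling k j)
lah-expansion zero zero    k       = refl
lah-expansion zero (suc n) zero    =
  trans (rising-zero n) (sym (sumTo-zero (suc n) _ vanishes))
  where
  vanishes : ∀ j → j ≤ suc n → lah zero (suc n) j * falling zero j ≡ 0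
  vanishes zero    _ = refl
  vanishes (suc j) _ = trans (cong (lah zero (suc n) (suc j) *_) (*-zeroʳ (suc j !)))
                             (*-zeroʳ (lah zero (suc n) (suc j)))
lah-expansion zero (suc n) (suc k) = sym (begin
    sumTo (suc n) (λ j → lah zero (suc n) j * falling (suc k) j)
  ≡⟨ sumTo-shift n _ ⟩
    sumTo n (λ j → lah zero (suc n) (suc j) * falling (suc k) (suc j))
  ≡⟨ sumTo-cong n term ⟩
    sumTo n (λ j → suc n ! * ((suc k C (1 + j)) * (n C j)))
  ≡⟨ sumTo-*ˡ n (suc n !) _ ⟩
    suc n ! * sumTo n (λ j → (suc k C (1 + j)) * (n C j))
  ≡⟨ cong (suc n ! *_) (vandermonde (suc k) n 1 n ≤-refl) ⟩
    suc n ! * ((suc k + n) C (1 + n))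
  ≡⟨ cong (λ t → suc n ! * (suc t C suc n)) (+-comm k n) ⟩
    suc n ! * ((suc n + k) C suc n)
  ≡⟨ cong (suc n ! *_) (binomial-symmetric (suc n) k) ⟩
    suc n ! * ((k + suc n) C k)
  ≡⟨ sym (rising-binomial k (suc n)) ⟩
    rising (suc k) (suc n)
  ≡⟨ cong (λ t → rising t (suc n)) (sym (+-identityʳ (suc k))) ⟩
    rising (suc k + 0) (suc n) ∎)
  where
  open ≡-Reasoning
  term : ∀ j → j ≤ n →
    lah zero (suc n) (suc j) * falling (suc k) (suc j) ≡ suc n ! * ((suc k C (1 + j)) * (n C j))
  term j j≤n = begin
      lah zero (suc n) (suc j) * (suc j ! * (suc k C suc j))
    ≡⟨ sym (*-assoc (lah zero (suc n) (suc j)) (suc j !) (suc k C suc j)) ⟩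
      lah zero (suc n) (suc j) * suc j ! * (suc k C suc j)
    ≡⟨ cong (_* (suc k C suc j)) (lah-scaled zero (suc n) (suc j) j (s≤s j≤n) (cong suc (+-identityʳ j))) ⟩
      suc n ! * ((suc n + 0 ∸ 1) C j) * (suc k C suc j)
    ≡⟨ cong (λ t → suc n ! * (t C j) * (suc k C suc j)) (+-identityʳ n) ⟩
      suc n ! * (n C j) * (suc k C suc j)
    ≡⟨ *-assoc (suc n !) _ _ ⟩
      suc n ! * ((n C j) * (suc k C suc j))
    ≡⟨ cong (suc n ! *_) (*-comm (n C j) _) ⟩
      suc n ! * ((suc k C (1 + j)) * (n C j)) ∎
lah-expansion (suc r) n k = begin
    rising (k + suc c) n
  ≡⟨ cong (λ t → rising t n) (+-suc k c) ⟩
    rising (suc (k + c)) n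
  ≡⟨ rising-binomial (k + c) n ⟩
    n ! * ((k + c + n) C (k + c))
  ≡⟨ cong₂ (λ a b → n ! * (a C b)) (reorder k c n) (+-comm k c) ⟩
    n ! * ((n + c + k) C (c + k))
  ≡⟨ cong (n ! *_) (sym (vandermonde (n + c) k c (n + k) (m≤n+m k n))) ⟩
    n ! * sumTo (n + k) g
  ≡⟨ cong (n ! *_) (sumTo-vanishing-tail n k g vanishes) ⟩
    n ! * sumTo n g
  ≡⟨ sym (sumTo-*ˡ n (n !) g) ⟩
    sumTo n (λ j → n ! * g j)
  ≡⟨ sym (sumTo-cong n term) ⟩
    sumTo n (λ j → lah (suc r) n j * falling k j) ∎
  where
  open ≡-Reasoning
  c : ℕ
  c = r + suc r
  reorder : ∀ k c n → k + c + n ≡ n + c + k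
  reorder = solve-∀
  g : ℕ → ℕ
  g j = ((n + c) C (c + j)) * (k C j)
  vanishes : ∀ j → n < j → g j ≡ 0
  vanishes j n<j = cong (_* (k C j)) (k>n⇒nCk≡0 (subst (_< c + j) (+-comm c n) (+-monoʳ-< c n<j)))
  term : ∀ j → j ≤ n → lah (suc r) n j * falling k j ≡ n ! * g j
  term j j≤n = begin
      lah (suc r) n j * (j ! * (k C j))
    ≡⟨ sym (*-assoc (lah (suc r) n j) (j !) (k C j)) ⟩
      lah (suc r) n j * j ! * (k C j)
    ≡⟨ cong (_* (k C j)) (lah-scaled (suc r) n j (j + c) j≤n (+-suc j c)) ⟩
      n ! * ((n + suc c ∸ 1) C (j + c)) * (k C j)
    ≡⟨ cong₂ (λ a b → n ! * (a C b) * (k C j)) (cong (_∸ 1) (+-suc n c)) (+-comm j c) ⟩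
      n ! * ((n + c) C (c + j)) * (k C j)
    ≡⟨ *-assoc (n !) _ _ ⟩
      n ! * g j ∎

-- The exact identity at level M.  All partial sums are scaled by M!, so that
-- the term 1/k! becomes the natural number M!/k! = factRatio M k.

falling-factRatio : ∀ M j i → j + i ≤ M → falling (j + i) j * factRatio M (j + i) ≡ factRatio M i
falling-factRatio M j i j+i≤M = *-cancelʳ-≡ _ _ (i !) {{i !≢0}} (begin
    j ! * ((j + i) C j) * factRatio M (j + i) * i !
  ≡⟨ rearrange (j !) ((j + i) C j) (factRatio M (j + i)) (i !) ⟩
    factRatio M (j + i) * (((j + i) C j) * (j ! * i !))
  ≡⟨ cong (factRatio M (j + i) *_) (binomial-factorial j i) ⟩
    factRatio M (j + i) * (j + i) !
  ≡⟨ factRatio-factorial M (j + i) j+i≤M ⟩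
    M !
  ≡⟨ sym (factRatio-factorial M i (≤-trans (m≤n+m i j) j+i≤M)) ⟩
    factRatio M i * i ! ∎)
  where
  open ≡-Reasoning
  rearrange : ∀ a b c d → a * b * c * d ≡ c * (b * (a * d))
  rearrange = solve-∀

-- Σ_{k<M} (k)_j · M!/k! = Σ_{i<M-j} M!/i!: the terms k < j vanish and the
-- others are re-indexed by i = k - j.
falling-sum : ∀ M j → j ≤ M → sumBelow M (λ k → falling k j * factRatio M k) ≡ sumBelow (M ∸ j) (factRatio M)
falling-sum M j j≤M = begin
    sumBelow M f
  ≡⟨ cong (λ m → sumBelow m f) (sym (m+[n∸m]≡n j≤M)) ⟩
    sumBelow (j + (M ∸ j)) f
  ≡⟨ sumBelow-split j (M ∸ j) f ⟩
    sumBelow j f + sumBelow (M ∸ j) (λ i → f (j + i))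
  ≡⟨ cong₂ _+_ (sumBelow-zero j f vanishes) (sumBelow-cong (M ∸ j) (λ i i<M∸j → falling-factRatio M j i (in-range i i<M∸j))) ⟩
    sumBelow (M ∸ j) (factRatio M) ∎
  where
  open ≡-Reasoning
  f : ℕ → ℕ
  f k = falling k j * factRatio M k
  vanishes : ∀ k → k < j → f k ≡ 0
  vanishes k k<j = trans (cong (λ t → j ! * t * factRatio M k) (k>n⇒nCk≡0 k<j)) (cong (_* factRatio M k) (*-zeroʳ (j !)))
  in-range : ∀ i → i < M ∸ j → j + i ≤ M
  in-range i i<M∸j = subst (j + i ≤_) (m+[n∸m]≡n j≤M) (+-monoʳ-≤ j (<⇒≤ i<M∸j))

-- The last j terms of M!·E_M:  R_M(j) = Σ_{i<j} M!/(M-j+i)!.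
remainder : ℕ → ℕ → ℕ
remainder M j = sumBelow j (λ i → factRatio M ((M ∸ j) + i))

scaledE-split : ∀ M j → j ≤ M → sumBelow M (factRatio M) ≡ sumBelow (M ∸ j) (factRatio M) + remainder M j
scaledE-split M j j≤M =
  trans (cong (λ m → sumBelow m (factRatio M)) (sym (m∸n+n≡m j≤M))) (sumBelow-split (M ∸ j) j (factRatio M))

-- Each of the j terms of R_M(j) is M!/k! with k ≥ M - n, so R_M(j)·(M-n)! ≤ j·M!.
remainder-bound : ∀ M n j → j ≤ n → n ≤ M → remainder M j * (M ∸ n) ! ≤ j * M !
remainder-bound M n j j≤n n≤M =
  ≤-trans (≤-reflexive (sym (sumBelow-*ʳ j ((M ∸ n) !) (λ i → factRatio M ((M ∸ j) + i)))))
          (sumBelow-bound j (M !) _ term-bound)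
  where
  term-bound : ∀ i → i < j → factRatio M ((M ∸ j) + i) * (M ∸ n) ! ≤ M !
  term-bound i i<j = begin
      factRatio M k * (M ∸ n) !
    ≤⟨ *-monoʳ-≤ (factRatio M k) (factorial-mono (≤-trans (∸-monoʳ-≤ M j≤n) (m≤m+n (M ∸ j) i))) ⟩
      factRatio M k * k !
    ≡⟨ factRatio-factorial M k k≤M ⟩
      M ! ∎
    where
    open ≤-Reasoning
    k : ℕ
    k = (M ∸ j) + i
    k≤M : k ≤ M
    k≤M = ≤-trans (+-monoʳ-≤ (M ∸ j) (<⇒≤ i<j)) (≤-reflexive (m∸n+n≡m (≤-trans j≤n n≤M)))

scaledSeries : ℕ → ℕ → ℕ → ℕ
scaledSeries n r M = sumBelow M (λ k → rising (k + (r + r)) n * factRatio M k)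

scaledE : ℕ → ℕ
scaledE M = sumBelow M (factRatio M)

defect : ℕ → ℕ → ℕ → ℕ
defect n r M = sumTo n (λ j → lah r n j * remainder M j)

-- Inserting the Lah expansion and summing over k first:
--   M!·S_M = Σ_{j≤n} L_r(n,j) · Σ_{i<M-j} M!/i!.
scaledSeries-lah : ∀ n r M → n ≤ M →
  scaledSeries n r M ≡ sumTo n (λ j → lah r n j * sumBelow (M ∸ j) (factRatio M))
scaledSeries-lah n r M n≤M = begin
    sumBelow M (λ k → rising (k + (r + r)) n * factRatio M k)
  ≡⟨ sumBelow-cong M (λ k _ → cong (_* factRatio M k) (lah-expansion r n k)) ⟩
    sumBelow M (λ k → sumTo n (λ j → L j * falling k j) * factRatio M k)
  ≡⟨ sumBelow-cong M (λ k _ → distribute k) ⟩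
    sumBelow M (λ k → sumTo n (λ j → L j * (falling k j * factRatio M k)))
  ≡⟨ sumBelow-sumTo-swap M n (λ j k → L j * (falling k j * factRatio M k)) ⟩
    sumTo n (λ j → sumBelow M (λ k → L j * (falling k j * factRatio M k)))
  ≡⟨ sumTo-cong n (λ j j≤n → trans (sumBelow-*ˡ M (L j) (λ k → falling k j * factRatio M k))
                                   (cong (L j *_) (falling-sum M j (≤-trans j≤n n≤M)))) ⟩
    sumTo n (λ j → L j * sumBelow (M ∸ j) (factRatio M)) ∎
  where
  open ≡-Reasoning
  L : ℕ → ℕ
  L = lah r n
  distribute : ∀ k → sumTo n (λ j → L j * falling k j) * factRatio M k
                   ≡ sumTo n (λ j → L j * (falling k j * factRatio M k))
  distribute k = trans (sym (sumTo-*ʳ n (factRatio M k) (λ j → L j * falling k j)))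
                       (sumTo-cong n (λ j _ → *-assoc (L j) (falling k j) (factRatio M k)))

scaled-identity : ∀ n r M → n ≤ M → scaledSeries n r M + defect n r M ≡ lahBell n r * scaledE M
scaled-identity n r M n≤M = begin
    scaledSeries n r M + defect n r M
  ≡⟨ cong (_+ defect n r M) (scaledSeries-lah n r M n≤M) ⟩
    sumTo n (λ j → L j * T j) + sumTo n (λ j → L j * remainder M j)
  ≡⟨ sym (sumTo-+ n _ _) ⟩
    sumTo n (λ j → L j * T j + L j * remainder M j)
  ≡⟨ sumTo-cong n (λ j j≤n → trans (sym (*-distribˡ-+ (L j) (T j) (remainder M j)))
                                   (cong (L j *_) (sym (scaledE-split M j (≤-trans j≤n n≤M))))) ⟩
    sumTo n (λ j → L j * scaledE M)
  ≡⟨ sumTo-*ʳ n (scaledE M) L ⟩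
    lahBell n r * scaledE M ∎
  where
  open ≡-Reasoning
  L T : ℕ → ℕ
  L = lah r n
  T j = sumBelow (M ∸ j) (factRatio M)

defect-bound : ∀ n r M → n ≤ M → defect n r M * (M ∸ n) ! ≤ lahBell n r * (n * M !)
defect-bound n r M n≤M = begin
    defect n r M * (M ∸ n) !
  ≡⟨ sym (sumTo-*ʳ n ((M ∸ n) !) (λ j → lah r n j * remainder M j)) ⟩
    sumTo n (λ j → lah r n j * remainder M j * (M ∸ n) !)
  ≤⟨ sumTo-mono n term-bound ⟩
    sumTo n (λ j → lah r n j * (n * M !))
  ≡⟨ sumTo-*ʳ n (n * M !) (lah r n) ⟩
    lahBell n r * (n * M !) ∎
  where
  open ≤-Reasoning
  term-bound : ∀ j → j ≤ n → lah r n j * remainder M j * (M ∸ n) ! ≤ lah r n j * (n * M !)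
  term-bound j j≤n = begin
      lah r n j * remainder M j * (M ∸ n) !
    ≡⟨ *-assoc (lah r n j) (remainder M j) ((M ∸ n) !) ⟩
      lah r n j * (remainder M j * (M ∸ n) !)
    ≤⟨ *-monoʳ-≤ (lah r n j) (remainder-bound M n j j≤n n≤M) ⟩
      lah r n j * (j * M !)
    ≤⟨ *-monoʳ-≤ (lah r n j) (*-monoˡ-≤ (M !) j≤n) ⟩
      lah r n j * (n * M !) ∎

-- The defect is small against M!:  D_M · t < M!  once M ≥ n + 1 + B^L_{n,r}·n·t,
-- because then (M-n)! > B^L_{n,r}·n·t.
defect-small : ∀ n r M t → n + suc (lahBell n r * n * t) ≤ M → defect n r M * t < M !
defect-small n r M t M-large = *-cancelʳ-< X (defect n r M * t) (M !) (begin-strict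
    defect n r M * t * X
  ≡⟨ swap₂₃ (defect n r M) t X ⟩
    defect n r M * X * t
  ≤⟨ *-monoˡ-≤ t (defect-bound n r M n≤M) ⟩
    lahBell n r * (n * M !) * t
  ≡⟨ regroup (lahBell n r) n (M !) t ⟩
    K * M !
  <⟨ *-monoˡ-< (M !) {{M !≢0}} K<X ⟩
    X * M !
  ≡⟨ *-comm X (M !) ⟩
    M ! * X ∎)
  where
  open ≤-Reasoning
  K X : ℕ
  K = lahBell n r * n * t
  X = (M ∸ n) !
  n≤M : n ≤ M
  n≤M = ≤-trans (m≤m+n n (suc K)) M-large
  K<X : K < X
  K<X = ≤-trans (≤-trans (≤-reflexive (sym (m+n∸m≡n n (suc K)))) (∸-monoˡ-≤ n M-large)) (n≤n! (M ∸ n))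
  swap₂₃ : ∀ a b c → a * b * c ≡ a * c * b
  swap₂₃ = solve-∀
  regroup : ∀ b n p t → b * (n * p) * t ≡ b * n * t * p
  regroup = solve-∀

-- Transfer to ℚ.  Computations are done in unnormalised rationals ℚᵘ, where
-- fractions with a common denominator can be manipulated by ring identities.

frac : ℕ → (P : ℕ) → .{{NonZero P}} → ℚᵘ
frac x (suc p) = mkℚᵘ (ℤ.+ x) p

frac-≃ : ∀ x y P Q .{{_ : NonZero P}} .{{_ : NonZero Q}} → x * Q ≡ y * P → frac x P ≃ frac y Q
frac-≃ x y (suc p) (suc q) eq = *≡* (trans (sym (ℤP.pos-* x (suc q))) (trans (cong ℤ.+_ eq) (ℤP.pos-* y (suc p))))

frac-+ : ∀ x y P Q .{{_ : NonZero P}} .{{_ : NonZero Q}} →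
  frac x P +ᵘ frac y Q ≃ frac (x * Q + y * P) (P * Q) {{m*n≢0 P Q}}
frac-+ x y (suc p) (suc q) = ℚᵘP.≃-reflexive (cong (λ z → mkℚᵘ z (q + p * suc q))
  (sym (trans (ℤP.pos-+ (x * suc q) (y * suc p)) (cong₂ ℤ._+_ (ℤP.pos-* x (suc q)) (ℤP.pos-* y (suc p))))))

frac-* : ∀ x y P Q .{{_ : NonZero P}} .{{_ : NonZero Q}} →
  frac x P *ᵘ frac y Q ≃ frac (x * y) (P * Q) {{m*n≢0 P Q}}
frac-* x y (suc p) (suc q) = ℚᵘP.≃-reflexive (cong (λ z → mkℚᵘ z (q + p * suc q)) (sym (ℤP.pos-* x y)))

frac-< : ∀ x y P Q .{{_ : NonZero P}} .{{_ : NonZero Q}} → x * Q < y * P → frac x P <ᵘ frac y Q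
frac-< x y (suc p) (suc q) lt = *<* (subst₂ ℤ._<_ (ℤP.pos-* x (suc q)) (ℤP.pos-* y (suc p)) (ℤ.+<+ lt))

frac-∣-∣ : ∀ d P .{{_ : NonZero P}} → ∣ -ᵘ frac d P ∣ᵘ ≃ frac d P
frac-∣-∣ d (suc p) = ℚᵘP.≃-reflexive (cong (λ z → mkℚᵘ (ℤ.+ z) p) (ℤP.∣-i∣≡∣i∣ (ℤ.+ d)))

frac-difference : ∀ s d y P .{{_ : NonZero P}} → s + d ≡ y → frac s P +ᵘ -ᵘ frac y P ≃ -ᵘ frac d P
frac-difference s d y (suc p) s+d≡y = *≡* (begin
    (ℤ.+ s ℤ.* ℤ.+ suc p ℤ.+ ℤ.- ℤ.+ y ℤ.* ℤ.+ suc p) ℤ.* ℤ.+ suc p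
  ≡⟨ cong (λ t → (ℤ.+ s ℤ.* ℤ.+ suc p ℤ.+ ℤ.- t ℤ.* ℤ.+ suc p) ℤ.* ℤ.+ suc p)
          (trans (cong ℤ.+_ (sym s+d≡y)) (ℤP.pos-+ s d)) ⟩
    (ℤ.+ s ℤ.* ℤ.+ suc p ℤ.+ ℤ.- (ℤ.+ s ℤ.+ ℤ.+ d) ℤ.* ℤ.+ suc p) ℤ.* ℤ.+ suc p
  ≡⟨ cancel (ℤ.+ s) (ℤ.+ d) (ℤ.+ suc p) ⟩
    ℤ.- ℤ.+ d ℤ.* (ℤ.+ suc p ℤ.* ℤ.+ suc p)
  ≡⟨ cong (ℤ.- ℤ.+ d ℤ.*_) (sym (ℤP.pos-* (suc p) (suc p))) ⟩
    ℤ.- ℤ.+ d ℤ.* ℤ.+ (suc p * suc p) ∎)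
  where
  open ≡-Reasoning
  cancel : ∀ a b c → (a ℤ.* c ℤ.+ ℤ.- (a ℤ.+ b) ℤ.* c) ℤ.* c ≡ ℤ.- b ℤ.* (c ℤ.* c)
  cancel = ℤSolver.solve-∀

toℚᵘ-/ : ∀ x P .{{_ : NonZero P}} → toℚᵘ ((ℤ.+ x) / P) ≃ frac x P
toℚᵘ-/ x (suc p) = ℚP.toℚᵘ-fromℚᵘ (mkℚᵘ (ℤ.+ x) p)

factRatio-step : ∀ M k → k ≤ M → factRatio (suc M) k ≡ suc M * factRatio M k
factRatio-step M k k≤M = *-cancelʳ-≡ _ _ (k !) {{k !≢0}} (begin
    factRatio (suc M) k * k !
  ≡⟨ factRatio-factorial (suc M) k (m≤n⇒m≤1+n k≤M) ⟩
    suc M * M !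
  ≡⟨ cong (suc M *_) (sym (factRatio-factorial M k k≤M)) ⟩
    suc M * (factRatio M k * k !)
  ≡⟨ sym (*-assoc (suc M) (factRatio M k) (k !)) ⟩
    suc M * factRatio M k * k ! ∎)
  where open ≡-Reasoning

scaled-sum-step : ∀ M (f : ℕ → ℕ) →
  sumBelow (suc M) (λ k → f k * factRatio (suc M) k) ≡ suc M * (sumBelow M (λ k → f k * factRatio M k) + f M)
scaled-sum-step M f = begin
    sumBelow M (λ k → f k * factRatio (suc M) k) + f M * factRatio (suc M) M
  ≡⟨ cong₂ _+_ (sumBelow-cong M (λ k k<M → cong (f k *_) (factRatio-step M k (<⇒≤ k<M))))
               (cong (f M *_) (factRatio-step M M ≤-refl)) ⟩
    sumBelow M (λ k → f k * (suc M * factRatio M k)) + f M * (suc M * factRatio M M)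
  ≡⟨ cong₂ _+_ (sumBelow-cong M (λ k _ → x*[y*z]≡y*[x*z] (f k) (suc M) (factRatio M k)))
               (cong (λ t → f M * (suc M * rising (suc M) t)) (n∸n≡0 M)) ⟩
    sumBelow M (λ k → suc M * (f k * factRatio M k)) + f M * (suc M * 1)
  ≡⟨ cong₂ _+_ (sumBelow-*ˡ M (suc M) (λ k → f k * factRatio M k)) (x*[y*1]≡y*x (f M) (suc M)) ⟩
    suc M * sumBelow M (λ k → f k * factRatio M k) + suc M * f M
  ≡⟨ sym (*-distribˡ-+ (suc M) _ (f M)) ⟩
    suc M * (sumBelow M (λ k → f k * factRatio M k) + f M) ∎
  where
  open ≡-Reasoning
  x*[y*z]≡y*[x*z] : ∀ x y z → x * (y * z) ≡ y * (x * z)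
  x*[y*z]≡y*[x*z] = solve-∀
  x*[y*1]≡y*x : ∀ x y → x * (y * 1) ≡ y * x
  x*[y*1]≡y*x = solve-∀

partial-sum-fraction : ∀ M (f : ℕ → ℕ) →
  toℚᵘ (sumBelowℚ M (λ k → ((ℤ.+ f k) / (k !)) {{k !≢0}}))
    ≃ frac (sumBelow M (λ k → f k * factRatio M k)) (M !) {{M !≢0}}
partial-sum-fraction zero    f = ℚᵘP.≃-refl
partial-sum-fraction (suc M) f = begin
    toℚᵘ (sumBelowℚ M term +ℚ term M)
  ≈⟨ ℚP.toℚᵘ-homo-+ (sumBelowℚ M term) (term M) ⟩
    toℚᵘ (sumBelowℚ M term) +ᵘ toℚᵘ (term M)
  ≈⟨ ℚᵘP.+-cong (partial-sum-fraction M f) (toℚᵘ-/ (f M) (M !)) ⟩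
    frac A (M !) +ᵘ frac (f M) (M !)
  ≈⟨ frac-+ A (f M) (M !) (M !) ⟩
    frac (A * M ! + f M * M !) (M ! * M !) {{m*n≢0 (M !) (M !)}}
  ≈⟨ frac-≃ _ _ (M ! * M !) (suc M !) {{m*n≢0 (M !) (M !)}} {{suc M !≢0}} cross ⟩
    frac (suc M * (A + f M)) (suc M !) {{suc M !≢0}}
  ≡⟨ cong (λ t → frac t (suc M !) {{suc M !≢0}}) (sym (scaled-sum-step M f)) ⟩
    frac (sumBelow (suc M) (λ k → f k * factRatio (suc M) k)) (suc M !) {{suc M !≢0}} ∎
  where
  open ℚᵘP.≃-Reasoning
  instance
    M!≢0 : NonZero (M !)
    M!≢0 = M !≢0
  term : ℕ → ℚ
  term k = ((ℤ.+ f k) / (k !)) {{k !≢0}}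
  A : ℕ
  A = sumBelow M (λ k → f k * factRatio M k)
  cross : (A * M ! + f M * M !) * (suc M * M !) ≡ suc M * (A + f M) * (M ! * M !)
  cross = common-denominator A (f M) (suc M) (M !)
    where
    common-denominator : ∀ a b m p → (a * p + b * p) * (m * p) ≡ m * (a + b) * (p * p)
    common-denominator = solve-∀

difference-fraction : ∀ n r M → n ≤ M →
  toℚᵘ ∣ seriesPartial n r M - ((ℤ.+ lahBell n r) / 1) *ℚ ePartial M ∣ ≃ frac (defect n r M) (M !) {{M !≢0}}
difference-fraction n r M n≤M = begin
    toℚᵘ ∣ S - Y ∣
  ≈⟨ ℚP.toℚᵘ-homo-∣-∣ (S - Y) ⟩
    ∣ toℚᵘ (S +ℚ -ℚ Y) ∣ᵘ
  ≈⟨ ℚᵘP.∣-∣-cong (ℚP.toℚᵘ-homo-+ S (-ℚ Y)) ⟩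
    ∣ toℚᵘ S +ᵘ toℚᵘ (-ℚ Y) ∣ᵘ
  ≈⟨ ℚᵘP.∣-∣-cong (ℚᵘP.+-cong (partial-sum-fraction M (λ k → rising (k + (r + r)) n))
                              (ℚᵘP.≃-trans (ℚP.toℚᵘ-homo‿- Y) (ℚᵘP.-‿cong Y-fraction))) ⟩
    ∣ frac (scaledSeries n r M) (M !) +ᵘ -ᵘ frac (B * scaledE M) (M !) ∣ᵘ
  ≈⟨ ℚᵘP.∣-∣-cong (frac-difference _ _ _ (M !) (scaled-identity n r M n≤M)) ⟩
    ∣ -ᵘ frac (defect n r M) (M !) ∣ᵘ
  ≈⟨ frac-∣-∣ (defect n r M) (M !) ⟩
    frac (defect n r M) (M !) ∎
  where
  open ℚᵘP.≃-Reasoning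
  instance
    M!≢0 : NonZero (M !)
    M!≢0 = M !≢0
  B : ℕ
  B = lahBell n r
  S Y : ℚ
  S = seriesPartial n r M
  Y = ((ℤ.+ B) / 1) *ℚ ePartial M
  E-fraction : toℚᵘ (ePartial M) ≃ frac (scaledE M) (M !)
  E-fraction = ℚᵘP.≃-trans (partial-sum-fraction M (λ _ → 1))
    (ℚᵘP.≃-reflexive (cong (λ t → frac t (M !)) (sumBelow-cong M (λ k _ → *-identityˡ (factRatio M k)))))
  Y-fraction : toℚᵘ Y ≃ frac (B * scaledE M) (M !)
  Y-fraction = begin
      toℚᵘ Y
    ≈⟨ ℚP.toℚᵘ-homo-* ((ℤ.+ B) / 1) (ePartial M) ⟩
      toℚᵘ ((ℤ.+ B) / 1) *ᵘ toℚᵘ (ePartial M)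
    ≈⟨ ℚᵘP.*-cong (toℚᵘ-/ B 1) E-fraction ⟩
      frac B 1 *ᵘ frac (scaledE M) (M !)
    ≈⟨ frac-* B (scaledE M) 1 (M !) ⟩
      frac (B * scaledE M) (1 * M !) {{m*n≢0 1 (M !)}}
    ≈⟨ frac-≃ _ _ (1 * M !) (M !) {{m*n≢0 1 (M !)}} (cong (B * scaledE M *_) (sym (*-identityˡ (M !)))) ⟩
      frac (B * scaledE M) (M !) ∎

-- A non-positive ε contradicts the hypothesis; for ε > 0 with
-- numerator a+1 and denominator q+1, the defect bound makes |S_M - B^L_{n,r}·E_M| = D_M/M! < 1/(q+1) ≤ ε as soon as
-- M ≥ n + 1 + B^L_{n,r}·n·(q+1).
theorem4 : (n r : ℕ) (ε : ℚ) → 0ℚ <ℚ ε →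
    Σ ℕ (λ N → (M : ℕ) → M ≥ N →
    ∣ seriesPartial n r M - ((ℤ.+ lahBell n r) / 1) *ℚ ePartial M ∣ <ℚ ε)
theorem4 n r (mkℚ (ℤ.+ zero)    _ _) (ℚ.*<* (ℤ.+<+ ()))
theorem4 n r (mkℚ ℤ.-[1+ _ ]    _ _) (ℚ.*<* ())
theorem4 n r ε@(mkℚ (ℤ.+ suc a) q _) _ = N , close
  where
  N : ℕ
  N = n + suc (lahBell n r * n * suc q)
  close : (M : ℕ) → M ≥ N →
    ∣ seriesPartial n r M - ((ℤ.+ lahBell n r) / 1) *ℚ ePartial M ∣ <ℚ ε
  close M M≥N = ℚP.toℚᵘ-cancel-<
    (ℚᵘP.<-respˡ-≃ (ℚᵘP.≃-sym (difference-fraction n r M (≤-trans (m≤m+n n _) M≥N)))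
                   (frac-< _ (suc a) (M !) (suc q) {{M !≢0}} defect-below-ε))
    where
    defect-below-ε : defect n r M * suc q < suc a * M !
    defect-below-ε = <-≤-trans (defect-small n r M (suc q) M≥N) (m≤n*m (M !) (suc a))
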